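{- Given a finite set $S$ of polynomials over a discrete commutative ring $R$, there is a finite set of polynomials in $R[X]$ containing $S$ that is closed under chopping and remaindering.
   Context: A discrete ring is one with decidable equality. For a nonzero polynomial $a$, the chop $\gamma(a)$ is $a$ with its leading term deleted; $\gamma(0)=0$. Pseudodivision: for polynomials $a$ of degree $m$ and $b$ of degree $n$ with $0\le m<n$, the standard pseudodivision algorithm gives canonical $q,r$ with $\deg r<m$ and $a_m^{\,n-m+1}b=qa+r$ ($a_m$ the leading coefficient of $a$); write $\rho(b,a)=r$, defined only when $0\le\deg a<\deg b$. For sets $A,B$ of polynomials, $\mathrm{Rem}(A,B)=\{p: p=\rho(a,b)\text{ or }p=\rho(b,a)\text{ for some }(a,b)\in A\times B\}$ (for those pairs where defined) and $\mathrm{Chop}(A)=\{\gamma(a):a\in A\}$. A set $A$ is closed under chopping and remaindering if $\mathrm{Rem}(A,A)\subseteq A$ and $\mathrm{Chop}(A)\subseteq A$. -}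

module Defs where

open import Level using (Level; _⊔_)
open import Algebra.Bundles using (CommutativeRing)
open import Relation.Binary.Definitions using (Decidable)
open import Relation.Nullary using (yes; no)
open import Data.List using (List; []; _∷_; length; replicate)
open import Data.List.Relation.Unary.Any using (Any)
open import Data.Maybe using (Maybe; just; nothing)
open import Data.Nat using (ℕ; zero; suc; _∸_; _<_)
open import Data.Product using (Σ; ∃; _×_)
open import Data.Sum using (_⊎_)
open import Relation.Binary.PropositionalEquality using (_≡_)

-- Polynomials in R[X] over a discrete commutative ring R (decidable _≈_),
-- represented as coefficient lists, lowest degree first.  Trailing zeros
-- are allowed in the representation; polynomial equality _≃_ is
-- coefficientwise equality (coefficients beyond the list are 0).
module PolyDefs {c ℓ : Level} (R : CommutativeRing c ℓ)
                (_≟_ : Decidable (CommutativeRing._≈_ R)) where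

  open CommutativeRing R

  Poly : Set c
  Poly = List Carrier

  coeff : Poly → ℕ → Carrier
  coeff []       _       = 0#
  coeff (x ∷ xs) zero    = x
  coeff (x ∷ xs) (suc i) = coeff xs i

  _≃_ : Poly → Poly → Set ℓ
  p ≃ q = ∀ i → coeff p i ≈ coeff q i

  strip : Poly → Poly
  strip [] = []
  strip (x ∷ xs) with strip xs
  ... | y ∷ ys = x ∷ y ∷ ys
  ... | [] with x ≟ 0#
  ...   | yes _ = []
  ...   | no  _ = x ∷ []

  -- degree; nothing encodes the degree of the zero polynomial (-∞)
  deg : Poly → Maybe ℕ
  deg p with strip p
  ... | []     = nothing
  ... | _ ∷ ys = just (length ys)

  dropLast : Poly → Poly
  dropLast []           = []
  dropLast (x ∷ [])     = []
  dropLast (x ∷ y ∷ ys) = x ∷ dropLast (y ∷ ys)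

  -- chop γ: delete the leading term; γ(0) = 0
  chop : Poly → Poly
  chop p = dropLast (strip p)

  _⊕_ : Poly → Poly → Poly
  []       ⊕ q        = q
  (x ∷ xs) ⊕ []       = x ∷ xs
  (x ∷ xs) ⊕ (y ∷ ys) = (x + y) ∷ (xs ⊕ ys)

  scale : Carrier → Poly → Poly
  scale k []       = []
  scale k (x ∷ xs) = (k * x) ∷ scale k xs

  neg : Poly → Poly
  neg []       = []
  neg (x ∷ xs) = (- x) ∷ neg xs

  shift : ℕ → Poly → Poly
  shift k p = replicate k 0# Data.List.++ p

  -- Pseudodivision of b by a, where deg a = m, leading coefficient a_m.
  -- One step at position k:  r ↦ a_m·r − r_{m+k}·X^k·a  (kills coefficient m+k).
  premStep : Poly → ℕ → ℕ → Poly → Poly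
  premStep a m k r = scale (coeff a m) r ⊕ neg (scale (coeff r (m Data.Nat.+ k)) (shift k a))

  premGo : Poly → ℕ → ℕ → Poly → Poly
  premGo a m zero    r = r
  premGo a m (suc j) r = premGo a m j (premStep a m j r)

  -- standard pseudoremainder ρ(b,a) when deg a = m < n = deg b:
  -- n − m + 1 steps, so that a_m^(n−m+1) b = q a + r with deg r < m.
  prem : Poly → Poly → ℕ → ℕ → Poly
  prem b a m n = premGo a m (suc (n ∸ m)) b

  IsRho : Poly → Poly → Poly → Set ℓ
  IsRho p b a = Σ ℕ λ m → Σ ℕ λ n →
    deg a ≡ just m × deg b ≡ just n × m < n × p ≃ prem b a m n

  -- finite sets of polynomials as lists; membership up to polynomial equality
  _∈P_ : Poly → List Poly → Set (c ⊔ ℓ)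
  p ∈P A = Any (p ≃_) A

  _⊆P_ : List Poly → List Poly → Set (c ⊔ ℓ)
  A ⊆P B = ∀ p → p ∈P A → p ∈P B

  Rem : List Poly → List Poly → Poly → Set (c ⊔ ℓ)
  Rem A B p = Σ Poly λ a → Σ Poly λ b →
    a ∈P A × b ∈P B × (IsRho p a b ⊎ IsRho p b a)

  Chop : List Poly → Poly → Set (c ⊔ ℓ)
  Chop A p = Σ Poly λ a → a ∈P A × p ≃ chop a

  ClosedChopRem : List Poly → Set (c ⊔ ℓ)
  ClosedChopRem A = (∀ p → Rem A A p → p ∈P A) × (∀ p → Chop A p → p ∈P A)

-- Measure a polynomial p by its size, the number of coefficients up to
-- the leading one (deg p + 1, and 0 for the zero polynomial).  Both operations
-- strictly decrease size: γ(p) has smaller size than a nonzero p, and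
-- ρ(b,a) has degree below deg a < deg b.  Any finite set closed under
-- size-decreasing operations can be completed to a finite closed set by
-- adding "children" round after round: after j rounds starting from a set
-- whose sizes are all < k, every output of size ≥ k − j is already present,
-- so k rounds suffice.
--
-- The theorem applies the completion lemma to
-- S together with the zero polynomial (the chop of a zero polynomial is 0)
-- and transfers closure along polynomial equality.
module Submission where

open import Defs
open import Level using (Level)
open import Algebra.Bundles using (CommutativeRing)
open import Relation.Binary.Bundles using (Setoid)
open import Relation.Binary.Definitions using (Decidable)
import Relation.Binary.Reasoning.Setoid as SetoidReasoning
open import Relation.Binary.PropositionalEquality using (_≡_; refl; sym; trans; cong; subst; module ≡-Reasoning)
open import Relation.Nullary using (yes; no)
open import Data.Empty using (⊥-elim)
open import Data.Product using (Σ; ∃; ∃₂; _×_; _,_; proj₁; proj₂)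
open import Data.Sum using (_⊎_; inj₁; inj₂)
open import Data.Maybe using (Maybe; just; nothing)
open import Data.Nat using (ℕ; zero; suc; _+_; _∸_; _≤_; _<_; z≤n; s≤s; _<?_)
open import Data.Nat.Properties
  using (≤-refl; ≤-reflexive; ≤-trans; ≤-antisym; ≤-<-trans; <-≤-trans; <⇒≤; <⇒≱;
         suc-injective; m≤m+n; +-comm; +-assoc; +-identityʳ; +-suc; m+[n∸m]≡n)
open import Data.List using (List; []; _∷_; length; map; concatMap; _++_)
open import Data.List.Relation.Unary.Any using (here; there)
open import Data.List.Relation.Unary.All using (lookup)
open import Data.List.Membership.Propositional using (_∈_; find; lose)
open import Data.List.Membership.Propositional.Properties
  using (∈-map⁺; ∈-++⁺ˡ; ∈-++⁺ʳ; ∈-++⁻; ∈-concatMap⁺; ∈-concatMap⁻)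
open import Data.List.Extrema.Nat using (max; xs≤max)

module SizeDecreasingClosure {a} {P : Set a} (size : P → ℕ)
  (bin : P → P → List P) (un : P → List P)
  (bin-shrinks : ∀ x y {z} → z ∈ bin x y → size z < size x × size z < size y)
  (un-shrinks  : ∀ x {z} → z ∈ un x → size z < size x) where

  children : List P → List P
  children A = concatMap (λ x → concatMap (bin x) A ++ un x) A

  bin∈children : ∀ {A x y z} → x ∈ A → y ∈ A → z ∈ bin x y → z ∈ children A
  bin∈children x∈ y∈ z∈ = ∈-concatMap⁺ _ (lose x∈ (∈-++⁺ˡ (∈-concatMap⁺ _ (lose y∈ z∈))))

  un∈children : ∀ {A x z} → x ∈ A → z ∈ un x → z ∈ children A
  un∈children {A} {x} x∈ z∈ = ∈-concatMap⁺ _ (lose x∈ (∈-++⁺ʳ (concatMap (bin x) A) z∈))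

  children-parents : ∀ {A w} → w ∈ children A →
    (∃₂ λ x y → x ∈ A × y ∈ A × w ∈ bin x y) ⊎ (∃ λ x → x ∈ A × w ∈ un x)
  children-parents {A} w∈ with find (∈-concatMap⁻ _ w∈)
  ... | x , x∈ , w∈x with ∈-++⁻ (concatMap (bin x) A) w∈x
  ...   | inj₂ w∈un = inj₂ (x , x∈ , w∈un)
  ...   | inj₁ w∈bins with find (∈-concatMap⁻ (bin x) w∈bins)
  ...     | y , y∈ , w∈bin = inj₁ (x , y , x∈ , y∈ , w∈bin)

  ClosedFrom : ℕ → List P → Set a
  ClosedFrom k A = (∀ {x y z} → x ∈ A → y ∈ A → z ∈ bin x y → k ≤ size z → z ∈ A)
                 × (∀ {x z} → x ∈ A → z ∈ un x → k ≤ size z → z ∈ A)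

  large⇒old : ∀ {k A x} → ClosedFrom (suc k) A → x ∈ A ++ children A → k < size x → x ∈ A
  large⇒old {A = A} (bin-closed , un-closed) x∈ k<x with ∈-++⁻ A x∈
  ... | inj₁ x∈A = x∈A
  ... | inj₂ x∈children with children-parents x∈children
  ...   | inj₁ (_ , _ , y∈ , z∈ , x∈bin) = bin-closed y∈ z∈ x∈bin k<x
  ...   | inj₂ (_ , y∈ , x∈un) = un-closed y∈ x∈un k<x

  -- One round of adding children lowers the closedness threshold by one: an
  -- output of size ≥ k has inputs of size > k, which therefore lie in A.
  grow : ∀ {k A} → ClosedFrom (suc k) A → ClosedFrom k (A ++ children A)
  grow {k} {A} closed =
      (λ x∈ y∈ z∈ k≤z → ∈-++⁺ʳ A (bin∈children (old x∈ (proj₁ (bin-shrinks _ _ z∈)) k≤z)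
                                                (old y∈ (proj₂ (bin-shrinks _ _ z∈)) k≤z) z∈))
    , (λ x∈ z∈ k≤z → ∈-++⁺ʳ A (un∈children (old x∈ (un-shrinks _ z∈) k≤z) z∈))
    where
    old : ∀ {x z} → x ∈ A ++ children A → size z < size x → k ≤ size z → x ∈ A
    old x∈ z<x k≤z = large⇒old closed x∈ (≤-<-trans k≤z z<x)

  iterate : ℕ → List P → List P
  iterate zero    A = A
  iterate (suc j) A = iterate j (A ++ children A)

  iterate-⊇ : ∀ j A {x} → x ∈ A → x ∈ iterate j A
  iterate-⊇ zero    A x∈ = x∈
  iterate-⊇ (suc j) A x∈ = iterate-⊇ j (A ++ children A) (∈-++⁺ˡ x∈)

  iterate-closed : ∀ j {A} → ClosedFrom j A → ClosedFrom 0 (iterate j A)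
  iterate-closed zero    closed = closed
  iterate-closed (suc j) closed = iterate-closed j (grow closed)

  maxSize : List P → ℕ
  maxSize A = max 0 (map size A)

  size≤maxSize : ∀ {A x} → x ∈ A → size x ≤ maxSize A
  size≤maxSize {A} x∈ = lookup (xs≤max 0 (map size A)) (∈-map⁺ size x∈)

  -- Outputs are smaller than their inputs, so none reaches the maximal size.
  closedFrom-maxSize : ∀ A → ClosedFrom (maxSize A) A
  closedFrom-maxSize A =
      (λ x∈ _ z∈ big → ⊥-elim (<⇒≱ (<-≤-trans (proj₁ (bin-shrinks _ _ z∈)) (size≤maxSize x∈)) big))
    , (λ x∈ z∈ big → ⊥-elim (<⇒≱ (<-≤-trans (un-shrinks _ z∈) (size≤maxSize x∈)) big))

  closure : ∀ A → Σ (List P) λ T → (∀ {x} → x ∈ A → x ∈ T)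
    × (∀ {x y z} → x ∈ T → y ∈ T → z ∈ bin x y → z ∈ T)
    × (∀ {x z} → x ∈ T → z ∈ un x → z ∈ T)
  closure A = iterate (maxSize A) A
            , iterate-⊇ (maxSize A) A
            , (λ x∈ y∈ z∈ → proj₁ closed x∈ y∈ z∈ z≤n)
            , (λ x∈ z∈ → proj₂ closed x∈ z∈ z≤n)
    where
    closed : ClosedFrom 0 (iterate (maxSize A) A)
    closed = iterate-closed (maxSize A) (closedFrom-maxSize A)

module Polynomials {c ℓ : Level} (R : CommutativeRing c ℓ)
    (_≟_ : Decidable (CommutativeRing._≈_ R)) where

  open CommutativeRing R
    using (_≈_; 0#; -_; setoid; ring; +-cong; *-cong; *-congˡ; -‿cong; *-comm; zeroʳ)
    renaming (_+_ to _+ᴿ_; _*_ to _*ᴿ_; refl to ≈-refl; sym to ≈-sym; trans to ≈-trans;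
              reflexive to ≈-reflexive; +-identityˡ to +ᴿ-identityˡ; +-identityʳ to +ᴿ-identityʳ)
  open import Algebra.Properties.Ring ring using (-0#≈0#; x≈y⇒x∙y⁻¹≈ε)
  open PolyDefs R _≟_

  ≃-setoid : Setoid c ℓ
  ≃-setoid = record
    { Carrier       = Poly
    ; _≈_           = _≃_
    ; isEquivalence = record
      { refl  = λ _ → ≈-refl
      ; sym   = λ p≃q i → ≈-sym (p≃q i)
      ; trans = λ p≃q q≃r i → ≈-trans (p≃q i) (q≃r i)
      }
    }

  open Setoid ≃-setoid using () renaming (sym to ≃-sym; trans to ≃-trans)
  module ≃-Reasoning = SetoidReasoning ≃-setoid
  module ≈-Reasoning = SetoidReasoning setoid

  size : Poly → ℕ
  size p = length (strip p)

  VanishesFrom : Poly → ℕ → Set ℓ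
  VanishesFrom p k = ∀ j → coeff p (k + j) ≈ 0#

  strip-≃ : ∀ p → strip p ≃ p
  strip-≃ [] _ = ≈-refl
  strip-≃ (x ∷ xs) with strip xs | strip-≃ xs
  ... | _ ∷ _ | tail≃ = λ { zero → ≈-refl ; (suc i) → tail≃ i }
  ... | []    | tail≃ with x ≟ 0#
  ...   | yes x≈0 = λ { zero → ≈-sym x≈0 ; (suc i) → tail≃ i }
  ...   | no  _   = λ { zero → ≈-refl    ; (suc i) → tail≃ i }

  coeff-beyond : ∀ l {i} → length l ≤ i → coeff l i ≡ 0#
  coeff-beyond []      _         = refl
  coeff-beyond (_ ∷ l) (s≤s l≤i) = coeff-beyond l l≤i

  vanishes-from-size : ∀ p {k} → size p ≤ k → VanishesFrom p k
  vanishes-from-size p {k} size≤k j = ≈-trans (≈-sym (strip-≃ p (k + j)))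
    (≈-reflexive (coeff-beyond (strip p) (≤-trans size≤k (m≤m+n k j))))

  size-bound : ∀ p k → VanishesFrom p k → size p ≤ k
  size-bound [] k _ = z≤n
  size-bound (x ∷ xs) zero van with strip xs | size-bound xs zero (λ j → van (suc j))
  ... | _ ∷ _ | ()
  ... | []    | _ with x ≟ 0#
  ...   | yes _   = z≤n
  ...   | no  x≉0 = ⊥-elim (x≉0 (van 0))
  size-bound (x ∷ xs) (suc k) van with strip xs | size-bound xs k van
  ... | _ ∷ _ | tail-bound = s≤s tail-bound
  ... | []    | _ with x ≟ 0#
  ...   | yes _ = z≤n
  ...   | no  _ = s≤s z≤n

  size≤length : ∀ l → size l ≤ length l
  size≤length l = size-bound l (length l) (λ j → ≈-reflexive (coeff-beyond l (m≤m+n _ j)))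

  size-mono : ∀ {p q} → p ≃ q → size p ≤ size q
  size-mono {p} {q} p≃q =
    size-bound p (size q) (λ j → ≈-trans (p≃q (size q + j)) (vanishes-from-size q ≤-refl j))

  size-cong : ∀ {p q} → p ≃ q → size p ≡ size q
  size-cong {p} {q} p≃q = ≤-antisym (size-mono {p} {q} p≃q) (size-mono {q} {p} (≃-sym {p} {q} p≃q))

  degOfSize : ℕ → Maybe ℕ
  degOfSize zero    = nothing
  degOfSize (suc n) = just n

  deg-size : ∀ p → deg p ≡ degOfSize (size p)
  deg-size p with strip p
  ... | []    = refl
  ... | _ ∷ _ = refl

  deg-cong : ∀ {p q} → p ≃ q → deg p ≡ deg q
  deg-cong {p} {q} p≃q = begin
    deg p                ≡⟨ deg-size p ⟩
    degOfSize (size p)   ≡⟨ cong degOfSize (size-cong {p} {q} p≃q) ⟩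
    degOfSize (size q)   ≡⟨ deg-size q ⟨
    deg q                ∎
    where open ≡-Reasoning

  size-of-deg : ∀ p {d} → deg p ≡ just d → size p ≡ suc d
  size-of-deg p deg≡d with strip p
  size-of-deg p ()   | []
  size-of-deg p refl | _ ∷ _ = refl

  dropLast-cong : ∀ l l′ → l ≃ l′ → length l ≡ length l′ → dropLast l ≃ dropLast l′
  dropLast-cong []           []             _    _   = λ _ → ≈-refl
  dropLast-cong (_ ∷ [])     (_ ∷ [])       _    _   = λ _ → ≈-refl
  dropLast-cong (x ∷ y ∷ l)  (x′ ∷ y′ ∷ l′) l≃l′ len = λ
    { zero    → l≃l′ zero
    ; (suc i) → dropLast-cong (y ∷ l) (y′ ∷ l′) (λ j → l≃l′ (suc j)) (suc-injective len) i }
  dropLast-cong []           (_ ∷ _)        _    ()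
  dropLast-cong (_ ∷ _)      []             _    ()
  dropLast-cong (_ ∷ [])     (_ ∷ _ ∷ _)    _    ()
  dropLast-cong (_ ∷ _ ∷ _)  (_ ∷ [])       _    ()

  -- γ respects polynomial equality: equal polynomials strip to lists of the
  -- same length with the same coefficients.
  chop-cong : ∀ {p q} → p ≃ q → chop p ≃ chop q
  chop-cong {p} {q} p≃q = dropLast-cong (strip p) (strip q) strip-p≃strip-q (size-cong {p} {q} p≃q)
    where
    open ≃-Reasoning
    strip-p≃strip-q : strip p ≃ strip q
    strip-p≃strip-q = begin
      strip p ≈⟨ strip-≃ p ⟩
      p       ≈⟨ p≃q ⟩
      q       ≈⟨ strip-≃ q ⟨
      strip q ∎

  length-dropLast : ∀ x (xs : Poly) → length (dropLast (x ∷ xs)) ≡ length xs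
  length-dropLast _ []       = refl
  length-dropLast _ (y ∷ ys) = cong suc (length-dropLast y ys)

  chop-shrinks : ∀ p {d} → deg p ≡ just d → size (chop p) < size p
  chop-shrinks p deg≡d with strip p
  chop-shrinks p () | []
  chop-shrinks p _  | y ∷ ys =
    s≤s (≤-trans (size≤length (dropLast (y ∷ ys))) (≤-reflexive (length-dropLast y ys)))

  coeff-⊕ : ∀ p q i → coeff (p ⊕ q) i ≈ coeff p i +ᴿ coeff q i
  coeff-⊕ []       _        _       = ≈-sym (+ᴿ-identityˡ _)
  coeff-⊕ (_ ∷ _)  []       _       = ≈-sym (+ᴿ-identityʳ _)
  coeff-⊕ (_ ∷ _)  (_ ∷ _)  zero    = ≈-refl
  coeff-⊕ (_ ∷ xs) (_ ∷ ys) (suc i) = coeff-⊕ xs ys i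

  coeff-scale : ∀ k p i → coeff (scale k p) i ≈ k *ᴿ coeff p i
  coeff-scale k []      _       = ≈-sym (zeroʳ k)
  coeff-scale k (_ ∷ _) zero    = ≈-refl
  coeff-scale k (_ ∷ p) (suc i) = coeff-scale k p i

  coeff-neg : ∀ p i → coeff (neg p) i ≈ - coeff p i
  coeff-neg []      _       = ≈-sym -0#≈0#
  coeff-neg (_ ∷ _) zero    = ≈-refl
  coeff-neg (_ ∷ p) (suc i) = coeff-neg p i

  coeff-shift : ∀ k p i → coeff (shift k p) (k + i) ≡ coeff p i
  coeff-shift zero    p i = refl
  coeff-shift (suc k) p i = coeff-shift k p i

  shift-cong : ∀ k {p q} → p ≃ q → shift k p ≃ shift k q
  shift-cong zero    p≃q         = p≃q
  shift-cong (suc k) p≃q zero    = ≈-refl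
  shift-cong (suc k) p≃q (suc i) = shift-cong k p≃q i

  coeff-premStep : ∀ a m k r i → coeff (premStep a m k r) i ≈
    coeff a m *ᴿ coeff r i +ᴿ - (coeff r (m + k) *ᴿ coeff (shift k a) i)
  coeff-premStep a m k r i = begin
    coeff (scale (coeff a m) r ⊕ neg (scale (coeff r (m + k)) (shift k a))) i
      ≈⟨ coeff-⊕ (scale (coeff a m) r) (neg (scale (coeff r (m + k)) (shift k a))) i ⟩
    coeff (scale (coeff a m) r) i +ᴿ coeff (neg (scale (coeff r (m + k)) (shift k a))) i
      ≈⟨ +-cong (coeff-scale (coeff a m) r i)
                (≈-trans (coeff-neg (scale (coeff r (m + k)) (shift k a)) i)
                         (-‿cong (coeff-scale (coeff r (m + k)) (shift k a) i))) ⟩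
    coeff a m *ᴿ coeff r i +ᴿ - (coeff r (m + k) *ᴿ coeff (shift k a) i) ∎
    where open ≈-Reasoning

  premStep-cong : ∀ {a a′} m k {r r′} → a ≃ a′ → r ≃ r′ → premStep a m k r ≃ premStep a′ m k r′
  premStep-cong {a} {a′} m k {r} {r′} a≃a′ r≃r′ i = begin
    coeff (premStep a m k r) i
      ≈⟨ coeff-premStep a m k r i ⟩
    coeff a m *ᴿ coeff r i +ᴿ - (coeff r (m + k) *ᴿ coeff (shift k a) i)
      ≈⟨ +-cong (*-cong (a≃a′ m) (r≃r′ i)) (-‿cong (*-cong (r≃r′ (m + k)) (shift-cong k a≃a′ i))) ⟩
    coeff a′ m *ᴿ coeff r′ i +ᴿ - (coeff r′ (m + k) *ᴿ coeff (shift k a′) i)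
      ≈⟨ coeff-premStep a′ m k r′ i ⟨
    coeff (premStep a′ m k r′) i ∎
    where open ≈-Reasoning

  premGo-cong : ∀ {a a′} m j {r r′} → a ≃ a′ → r ≃ r′ → premGo a m j r ≃ premGo a′ m j r′
  premGo-cong m zero    _    r≃r′ = r≃r′
  premGo-cong {a} {a′} m (suc j) {r} {r′} a≃a′ r≃r′ =
    premGo-cong m j a≃a′ (premStep-cong {a} {a′} m j {r} {r′} a≃a′ r≃r′)

  prem-cong : ∀ {b b′ a a′} m n → b ≃ b′ → a ≃ a′ → prem b a m n ≃ prem b′ a′ m n
  prem-cong {b} {b′} {a} {a′} m n b≃b′ a≃a′ = premGo-cong {a} {a′} m (suc (n ∸ m)) {b} {b′} a≃a′ b≃b′

  premStep-vanishes : ∀ a m k r → VanishesFrom a (suc m) → VanishesFrom r (suc (m + k)) →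
                      VanishesFrom (premStep a m k r) (m + k)
  premStep-vanishes a m k r a-vanishes r-vanishes j =
    ≈-trans (coeff-premStep a m k r (m + k + j)) (x≈y⇒x∙y⁻¹≈ε (terms-agree j))
    where
    open ≈-Reasoning
    shifted : ∀ j → coeff (shift k a) (m + k + j) ≡ coeff a (m + j)
    shifted j = trans (cong (coeff (shift k a)) (trans (cong (_+ j) (+-comm m k)) (+-assoc k m j)))
                      (coeff-shift k a (m + j))
    -- At index m + k both products are a_m·r_{m+k}; beyond it both vanish.
    terms-agree : ∀ j → coeff a m *ᴿ coeff r (m + k + j) ≈ coeff r (m + k) *ᴿ coeff (shift k a) (m + k + j)
    terms-agree zero = begin
      coeff a m *ᴿ coeff r (m + k + 0)  ≡⟨ cong (λ i → coeff a m *ᴿ coeff r i) (+-identityʳ (m + k)) ⟩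
      coeff a m *ᴿ coeff r (m + k)      ≈⟨ *-comm _ _ ⟩
      coeff r (m + k) *ᴿ coeff a m      ≡⟨ cong (coeff r (m + k) *ᴿ_) leading ⟨
      coeff r (m + k) *ᴿ coeff (shift k a) (m + k + 0) ∎
      where
      leading : coeff (shift k a) (m + k + 0) ≡ coeff a m
      leading = trans (shifted 0) (cong (coeff a) (+-identityʳ m))
    terms-agree (suc j) = begin
      coeff a m *ᴿ coeff r (m + k + suc j)  ≈⟨ *-congˡ r-beyond ⟩
      coeff a m *ᴿ 0#                       ≈⟨ zeroʳ _ ⟩
      0#                                    ≈⟨ zeroʳ _ ⟨
      coeff r (m + k) *ᴿ 0#                 ≈⟨ *-congˡ a-beyond ⟨
      coeff r (m + k) *ᴿ coeff (shift k a) (m + k + suc j) ∎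
      where
      r-beyond : coeff r (m + k + suc j) ≈ 0#
      r-beyond = ≈-trans (≈-reflexive (cong (coeff r) (+-suc (m + k) j))) (r-vanishes j)
      a-beyond : coeff (shift k a) (m + k + suc j) ≈ 0#
      a-beyond = ≈-trans (≈-reflexive (trans (shifted (suc j)) (cong (coeff a) (+-suc m j)))) (a-vanishes j)

  premGo-vanishes : ∀ a m j r → VanishesFrom a (suc m) → VanishesFrom r (m + j) →
                    VanishesFrom (premGo a m j r) m
  premGo-vanishes a m zero    r a-vanishes r-vanishes = subst (VanishesFrom r) (+-identityʳ m) r-vanishes
  premGo-vanishes a m (suc j) r a-vanishes r-vanishes =
    premGo-vanishes a m j (premStep a m j r) a-vanishes
      (premStep-vanishes a m j r a-vanishes (subst (VanishesFrom r) (+-suc m j) r-vanishes))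

  prem-small : ∀ b a {m n} → deg b ≡ just n → deg a ≡ just m → m < n → size (prem b a m n) ≤ m
  prem-small b a {m} {n} deg-b deg-a m<n =
    size-bound (prem b a m n) m (premGo-vanishes a m (suc (n ∸ m)) b a-vanishes b-vanishes)
    where
    a-vanishes : VanishesFrom a (suc m)
    a-vanishes = vanishes-from-size a (≤-reflexive (size-of-deg a deg-a))
    b-vanishes : VanishesFrom b (m + suc (n ∸ m))
    b-vanishes = subst (VanishesFrom b) (sym (trans (+-suc m (n ∸ m)) (cong suc (m+[n∸m]≡n (<⇒≤ m<n)))))
                       (vanishes-from-size b (≤-reflexive (size-of-deg b deg-b)))

  remainders : Poly → Poly → List Poly
  remainders b a with deg b | deg a
  ... | just n | just m with m <? n
  ...   | yes _ = prem b a m n ∷ []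
  ...   | no  _ = []
  remainders b a | _ | _ = []

  chops : Poly → List Poly
  chops p with deg p
  ... | just _  = chop p ∷ []
  ... | nothing = []

  remainders-shrink : ∀ b a {z} → z ∈ remainders b a → size z < size b × size z < size a
  remainders-shrink b a z∈ with deg b in deg-b | deg a in deg-a
  ... | just n | just m with m <? n
  remainders-shrink b a (here refl) | just n | just m | yes m<n =
      subst (size (prem b a m n) <_) (sym (size-of-deg b deg-b)) (s≤s (≤-trans small (<⇒≤ m<n)))
    , subst (size (prem b a m n) <_) (sym (size-of-deg a deg-a)) (s≤s small)
    where
    small : size (prem b a m n) ≤ m
    small = prem-small b a deg-b deg-a m<n

  chops-shrink : ∀ p {z} → z ∈ chops p → size z < size p
  chops-shrink p z∈ with deg p in deg-p
  chops-shrink p (here refl) | just _ = chop-shrinks p deg-p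

  remainders-complete : ∀ b a {m n} → deg b ≡ just n → deg a ≡ just m → m < n →
                        prem b a m n ∈ remainders b a
  remainders-complete b a {m} {n} deg-b deg-a m<n rewrite deg-b | deg-a with m <? n
  ... | yes _   = here refl
  ... | no  m≮n = ⊥-elim (m≮n m<n)

  strip-of-zero : ∀ p → deg p ≡ nothing → strip p ≡ []
  strip-of-zero p deg≡nothing with strip p
  strip-of-zero p refl | [] = refl
  strip-of-zero p ()   | _ ∷ _

  chops-complete : ∀ p → chop p ∈ chops p ⊎ chop p ≡ []
  chops-complete p with deg p in deg-p
  ... | just _  = inj₁ (here refl)
  ... | nothing = inj₂ (cong dropLast (strip-of-zero p deg-p))

  ∈⇒∈P : ∀ {p x T} → x ∈ T → p ≃ x → p ∈P T
  ∈⇒∈P {p} = lose {P = p ≃_}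

  ⊆⇒⊆P : ∀ {A B} → (∀ {x} → x ∈ A → x ∈ B) → A ⊆P B
  ⊆⇒⊆P A⊆B p p∈A with find p∈A
  ... | x , x∈A , p≃x = ∈⇒∈P {p} (A⊆B x∈A) p≃x

  -- A list containing 0 and closed on the nose under `remainders` and `chops`
  -- is closed under chopping and remaindering, since ρ and γ respect ≃.
  closed⇒ClosedChopRem : ∀ {T} → [] ∈ T →
    (∀ {x y z} → x ∈ T → y ∈ T → z ∈ remainders x y → z ∈ T) →
    (∀ {x z} → x ∈ T → z ∈ chops x → z ∈ T) →
    ClosedChopRem T
  closed⇒ClosedChopRem {T} 0∈T rem-closed chop-closed = rem-in , chop-in
    where
    rho-in : ∀ {p b a} → b ∈P T → a ∈P T → IsRho p b a → p ∈P T
    rho-in {p} {b} {a} b∈ a∈ (m , n , deg-a , deg-b , m<n , p≃ρ) with find b∈ | find a∈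
    ... | b′ , b′∈ , b≃b′ | a′ , a′∈ , a≃a′ = ∈⇒∈P {p} (rem-closed b′∈ a′∈ ρ′∈) p≃ρ′
      where
      open ≃-Reasoning
      ρ′∈ : prem b′ a′ m n ∈ remainders b′ a′
      ρ′∈ = remainders-complete b′ a′ (trans (sym (deg-cong {b} {b′} b≃b′)) deg-b)
                                      (trans (sym (deg-cong {a} {a′} a≃a′)) deg-a) m<n
      p≃ρ′ : p ≃ prem b′ a′ m n
      p≃ρ′ = begin
        p              ≈⟨ p≃ρ ⟩
        prem b a m n   ≈⟨ prem-cong {b} {b′} {a} {a′} m n b≃b′ a≃a′ ⟩
        prem b′ a′ m n ∎

    rem-in : ∀ p → Rem T T p → p ∈P T
    rem-in p (a , b , a∈ , b∈ , inj₁ ρ) = rho-in {p} {a} {b} a∈ b∈ ρ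
    rem-in p (a , b , a∈ , b∈ , inj₂ ρ) = rho-in {p} {b} {a} b∈ a∈ ρ

    chop-member : ∀ {p a} → a ∈ T → p ≃ chop a → p ∈P T
    chop-member {p} {a} a∈ p≃γa with chops-complete a
    ... | inj₁ γa∈ = ∈⇒∈P {p} (chop-closed a∈ γa∈) p≃γa
    ... | inj₂ γa≡0 = ∈⇒∈P {p} 0∈T (subst (p ≃_) γa≡0 p≃γa)

    chop-in : ∀ p → Chop T p → p ∈P T
    chop-in p (a , a∈ , p≃γa) with find a∈
    ... | a′ , a′∈ , a≃a′ =
      chop-member {p} a′∈ (≃-trans {p} {chop a} {chop a′} p≃γa (chop-cong {a} {a′} a≃a′))

mainTheorem19 : {c ℓ : Level} (R : CommutativeRing c ℓ)
    (_≟_ : Decidable (CommutativeRing._≈_ R))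
    (S : List (List (CommutativeRing.Carrier R))) →
    let open PolyDefs R _≟_ in
    Σ (List Poly) λ T → S ⊆P T × ClosedChopRem T
mainTheorem19 R _≟_ S =
  let open PolyDefs R _≟_
      open Polynomials R _≟_
      open SizeDecreasingClosure size remainders chops remainders-shrink chops-shrink
      T , 0∷S⊆T , rem-closed , chop-closed = closure ([] ∷ S)
  in T , ⊆⇒⊆P (λ x∈S → 0∷S⊆T (there x∈S))
       , closed⇒ClosedChopRem (0∷S⊆T (here refl)) rem-closed chop-closed
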